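{- Let $u,v$ be positive integers, and let $z=1/u$ or $z=v$. For every $n\ge 0$, $$S^{(u,v)}(z;n+1)>2\,S^{(u,v)}(z;n),$$ where $S^{(u,v)}(z;n)=\sum_{y\in\mathcal{T}^{(u,v)}(z;n)}y$.
   Context: The $(u,v)$-Calkin-Wilf tree $\mathcal{T}^{(u,v)}(z)$ with root a positive rational $z$ is the infinite binary tree whose root is labeled $z$ and in which every vertex labeled $a/b$ (with $a,b$ positive integers) has left child labeled $a/(ua+b)$ and right child labeled $(a+vb)/b$. $\mathcal{T}^{(u,v)}(z;n)$ denotes the collection of the $2^n$ vertices at depth $n$ (the root has depth $0$), and the sum runs over these $2^n$ vertices. -}

module Defs where

open import Data.Nat using (ℕ; zero; suc; _+_; _*_)
open import Data.Integer using (+_)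
open import Data.Rational using (ℚ; _/_; 0ℚ) renaming (_+_ to _+ℚ_)
open import Data.List using (List; []; _∷_; _++_; map; foldr; concatMap)
open import Data.Product using (_×_; _,_)

-- A vertex label a/b with a, b positive integers is stored as the pair
-- (a , b') with b = suc b' (so the denominator is visibly nonzero).
Label : Set
Label = ℕ × ℕ

val : Label → ℚ
val (a , b') = + a / suc b'

-- children in the (u,v)-Calkin-Wilf tree:
-- left child of a/b is a/(u a + b), right child is (a + v b)/b
leftChild : ℕ → Label → Label
leftChild u (a , b') = (a , u * a + b')

rightChild : ℕ → Label → Label
rightChild v (a , b') = (a + v * suc b' , b')

level : ℕ → ℕ → Label → ℕ → List Label
level u v r zero = r ∷ []
level u v r (suc n) =
  concatMap (λ x → leftChild u x ∷ rightChild v x ∷ []) (level u v r n)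

sumℚ : List ℚ → ℚ
sumℚ = foldr _+ℚ_ 0ℚ

S : ℕ → ℕ → Label → ℕ → ℚ
S u v r n = sumℚ (map val (level u v r n))

{-# OPTIONS --safe #-}
-- The right child of x is x + v, so S(n+1) = S(n) + G(n) + C(n), where G(n) sums the left
-- children x/(ux+1) of the depth-n vertices and C(n) = 2ⁿv; it suffices that S(n) < G(n) + C(n).
-- As the root is at most v, induction gives S(n) ≤ C(n) + G(0) + ⋯ + G(n-1).  Every right child
-- is at least v, hence at least the root, and x ↦ x/(ux+1) is increasing; so splitting the tree
-- at its root, the right subtree contributes at least G(n-1) and, by induction, the left subtree
-- more than G(0) + ⋯ + G(n-2).  Thus G(0) + ⋯ + G(n-1) < G(n).
module Submission where

open import Defs
open import Data.Nat using (ℕ; zero; suc; pred; NonZero; >-nonZero⁻¹; s≤s; z≤n)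
import Data.Nat as ℕ
import Data.Nat.Properties as ℕ
import Data.Integer as ℤ
import Data.Integer.Properties as ℤ
open import Data.Product using (_,_; proj₁)
open import Data.Rational using (ℚ; _<_; _≤_; _*_; 0ℚ; 1ℚ; _+_; fromℚᵘ; toℚᵘ)
open import Data.Rational.Properties
open import Data.Rational.Unnormalised as ℚᵘ using (mkℚᵘ; *≤*; *≡*) renaming (_≤_ to _≤ᵘ_)
import Data.Rational.Unnormalised.Properties as ℚᵘ
open import Data.Rational.Solver using () renaming (module +-*-Solver to ℚ-Solver)
open import Data.Nat.Solver using () renaming (module +-*-Solver to ℕ-Solver)
open import Data.List using (List; []; _∷_; _++_; map; concatMap)
open import Data.List.Properties using (map-++; map-cong; concatMap-++)
open import Data.Sum using (_⊎_; inj₁; inj₂)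
open import Function using (_∘_; const)
open import Relation.Binary.PropositionalEquality
  using (_≡_; refl; sym; trans; cong; cong₂; subst₂; module ≡-Reasoning)

fromℚᵘ-mono-≤ : ∀ {p q} → p ≤ᵘ q → fromℚᵘ p ≤ fromℚᵘ q
fromℚᵘ-mono-≤ {p} {q} p≤q = toℚᵘ-cancel-≤
  (ℚᵘ.≤-respˡ-≃ (ℚᵘ.≃-sym (toℚᵘ-fromℚᵘ p))
    (ℚᵘ.≤-respʳ-≃ (ℚᵘ.≃-sym (toℚᵘ-fromℚᵘ q)) p≤q))

fromℚᵘ-homo-+ : ∀ p q → fromℚᵘ (p ℚᵘ.+ q) ≡ fromℚᵘ p + fromℚᵘ q
fromℚᵘ-homo-+ p q = toℚᵘ-injective (begin-equality
  toℚᵘ (fromℚᵘ (p ℚᵘ.+ q))                 ≃⟨ toℚᵘ-fromℚᵘ (p ℚᵘ.+ q) ⟩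
  p ℚᵘ.+ q                                 ≃⟨ ℚᵘ.+-cong (toℚᵘ-fromℚᵘ p) (toℚᵘ-fromℚᵘ q) ⟨
  toℚᵘ (fromℚᵘ p) ℚᵘ.+ toℚᵘ (fromℚᵘ q)     ≃⟨ toℚᵘ-homo-+ (fromℚᵘ p) (fromℚᵘ q) ⟨
  toℚᵘ (fromℚᵘ p + fromℚᵘ q)               ∎)
  where open ℚᵘ.≤-Reasoning

sumℚ-++ : ∀ xs ys → sumℚ (xs ++ ys) ≡ sumℚ xs + sumℚ ys
sumℚ-++ []       ys = sym (+-identityˡ (sumℚ ys))
sumℚ-++ (x ∷ xs) ys = trans (cong (x +_) (sumℚ-++ xs ys)) (sym (+-assoc x (sumℚ xs) (sumℚ ys)))

sumℚ-map-+ : ∀ {A : Set} (f g : A → ℚ) xs →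
  sumℚ (map (λ x → f x + g x) xs) ≡ sumℚ (map f xs) + sumℚ (map g xs)
sumℚ-map-+ f g []       = refl
sumℚ-map-+ f g (x ∷ xs) = trans (cong (f x + g x +_) (sumℚ-map-+ f g xs))
  (solve 4 (λ a b c d → (a :+ b) :+ (c :+ d) := (a :+ c) :+ (b :+ d)) refl
    (f x) (g x) (sumℚ (map f xs)) (sumℚ (map g xs)))
  where open ℚ-Solver

_≼_ : Label → Label → Set
(a , b) ≼ (c , d) = a ℕ.* suc d ℕ.≤ c ℕ.* suc b

val-mono-≤ : ∀ {x y} → x ≼ y → val x ≤ val y
val-mono-≤ {a , b} {c , d} x≼y = fromℚᵘ-mono-≤ {mkℚᵘ (ℤ.+ a) b} {mkℚᵘ (ℤ.+ c) d}
  (*≤* (subst₂ ℤ._≤_ (ℤ.pos-* a (suc d)) (ℤ.pos-* c (suc b)) (ℤ.+≤+ x≼y)))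

val-pos : ∀ a b .{{_ : NonZero a}} → 0ℚ < val (a , b)
val-pos a b = positive⁻¹ (val (a , b)) {{normalize-pos a (suc b)}}

val-rightChild : ∀ v x → val (rightChild v x) ≡ val x + val (v , 0)
val-rightChild v (a , b) =
  trans (fromℚᵘ-cong {mkℚᵘ (ℤ.+ (a ℕ.+ v ℕ.* suc b)) b} {p ℚᵘ.+ q} (*≡* cross)) (fromℚᵘ-homo-+ p q)
  where
  open ≡-Reasoning
  p = mkℚᵘ (ℤ.+ a) b
  q = mkℚᵘ (ℤ.+ v) 0
  cross : ℤ.+ (a ℕ.+ v ℕ.* suc b) ℤ.* ℤ.+ suc (b ℕ.* 1)
        ≡ (ℤ.+ a ℤ.* ℤ.+ 1 ℤ.+ ℤ.+ v ℤ.* ℤ.+ suc b) ℤ.* ℤ.+ suc b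
  cross = begin
    ℤ.+ (a ℕ.+ v ℕ.* suc b) ℤ.* ℤ.+ suc (b ℕ.* 1)
      ≡⟨ cong₂ ℤ._*_ (ℤ.pos-+ a (v ℕ.* suc b)) (cong (ℤ.+_ ∘ suc) (ℕ.*-identityʳ b)) ⟩
    (ℤ.+ a ℤ.+ ℤ.+ (v ℕ.* suc b)) ℤ.* ℤ.+ suc b
      ≡⟨ cong (ℤ._* ℤ.+ suc b) (cong₂ ℤ._+_ (sym (ℤ.*-identityʳ (ℤ.+ a))) (ℤ.pos-* v (suc b))) ⟩
    (ℤ.+ a ℤ.* ℤ.+ 1 ℤ.+ ℤ.+ v ℤ.* ℤ.+ suc b) ℤ.* ℤ.+ suc b ∎

leftChild-mono : ∀ u {x y} → x ≼ y → leftChild u x ≼ leftChild u y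
leftChild-mono u {a , b} {c , d} x≼y = begin
  a ℕ.* suc (u ℕ.* c ℕ.+ d)      ≡⟨ expand a c d ⟩
  u ℕ.* (a ℕ.* c) ℕ.+ a ℕ.* suc d ≤⟨ ℕ.+-monoʳ-≤ (u ℕ.* (a ℕ.* c)) x≼y ⟩
  u ℕ.* (a ℕ.* c) ℕ.+ c ℕ.* suc b ≡⟨ cong (ℕ._+ c ℕ.* suc b) (cong (u ℕ.*_) (ℕ.*-comm a c)) ⟩
  u ℕ.* (c ℕ.* a) ℕ.+ c ℕ.* suc b ≡⟨ expand c a b ⟨
  c ℕ.* suc (u ℕ.* a ℕ.+ b)      ∎
  where
  open ℕ.≤-Reasoning
  expand : ∀ m n k → m ℕ.* suc (u ℕ.* n ℕ.+ k) ≡ u ℕ.* (m ℕ.* n) ℕ.+ m ℕ.* suc k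
  expand m n k = solve 4 (λ m n k u → m :* (con 1 :+ (u :* n :+ k)) := u :* (m :* n) :+ m :* (con 1 :+ k))
    refl m n k u
    where open ℕ-Solver

val-leftChild-mono : ∀ u x y → x ≼ y → val (leftChild u x) ≤ val (leftChild u y)
val-leftChild-mono u x y x≼y = val-mono-≤ {leftChild u x} {leftChild u y} (leftChild-mono u {x} {y} x≼y)

rightChild-mono : ∀ v {x y} → x ≼ y → rightChild v x ≼ rightChild v y
rightChild-mono v {a , b} {c , d} x≼y = begin
  (a ℕ.+ v ℕ.* suc b) ℕ.* suc d               ≡⟨ expand a (suc b) (suc d) ⟩
  a ℕ.* suc d ℕ.+ v ℕ.* (suc b ℕ.* suc d)     ≤⟨ ℕ.+-monoˡ-≤ _ x≼y ⟩
  c ℕ.* suc b ℕ.+ v ℕ.* (suc b ℕ.* suc d)     ≡⟨ cong ((c ℕ.* suc b ℕ.+_) ∘ (v ℕ.*_)) (ℕ.*-comm (suc b) (suc d)) ⟩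
  c ℕ.* suc b ℕ.+ v ℕ.* (suc d ℕ.* suc b)     ≡⟨ expand c (suc d) (suc b) ⟨
  (c ℕ.+ v ℕ.* suc d) ℕ.* suc b               ∎
  where
  open ℕ.≤-Reasoning
  expand : ∀ m n k → (m ℕ.+ v ℕ.* n) ℕ.* k ≡ m ℕ.* k ℕ.+ v ℕ.* (n ℕ.* k)
  expand m n k = trans (ℕ.*-distribʳ-+ k m (v ℕ.* n)) (cong (m ℕ.* k ℕ.+_) (ℕ.*-assoc v n k))

≼-rightChild : ∀ v {z} w → z ≼ (v , 0) → z ≼ rightChild v w
≼-rightChild v {a , b} (c , d) z≼v = begin
  a ℕ.* suc d                       ≡⟨ cong (ℕ._* suc d) (ℕ.*-identityʳ a) ⟨
  a ℕ.* 1 ℕ.* suc d                 ≤⟨ ℕ.*-monoˡ-≤ (suc d) z≼v ⟩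
  v ℕ.* suc b ℕ.* suc d             ≡⟨ ℕ.*-assoc v (suc b) (suc d) ⟩
  v ℕ.* (suc b ℕ.* suc d)           ≡⟨ cong (v ℕ.*_) (ℕ.*-comm (suc b) (suc d)) ⟩
  v ℕ.* (suc d ℕ.* suc b)           ≡⟨ ℕ.*-assoc v (suc d) (suc b) ⟨
  v ℕ.* suc d ℕ.* suc b             ≤⟨ ℕ.*-monoˡ-≤ (suc b) (ℕ.m≤n+m (v ℕ.* suc d) c) ⟩
  (c ℕ.+ v ℕ.* suc d) ℕ.* suc b     ∎
  where open ℕ.≤-Reasoning

module _ (u v : ℕ) where

  children : Label → List Label
  children x = leftChild u x ∷ rightChild v x ∷ []

  levelSum : (Label → ℚ) → Label → ℕ → ℚ
  levelSum φ r n = sumℚ (map φ (level u v r n))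

  sum-concatMap-children : ∀ φ xs → sumℚ (map φ (concatMap children xs))
    ≡ sumℚ (map (λ x → φ (leftChild u x) + φ (rightChild v x)) xs)
  sum-concatMap-children φ []       = refl
  sum-concatMap-children φ (x ∷ xs) =
    trans (cong (λ t → φ (leftChild u x) + (φ (rightChild v x) + t)) (sum-concatMap-children φ xs))
          (sym (+-assoc (φ (leftChild u x)) (φ (rightChild v x)) _))

  levelSum-suc : ∀ φ r n →
    levelSum φ r (suc n) ≡ levelSum (λ x → φ (leftChild u x) + φ (rightChild v x)) r n
  levelSum-suc φ r n = sum-concatMap-children φ (level u v r n)

  level-suc-root : ∀ r n →
    level u v r (suc n) ≡ level u v (leftChild u r) n ++ level u v (rightChild v r) n
  level-suc-root r zero    = refl
  level-suc-root r (suc n) = trans (cong (concatMap children) (level-suc-root r n))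
    (concatMap-++ children (level u v (leftChild u r) n) (level u v (rightChild v r) n))

  levelSum-suc-root : ∀ φ r n →
    levelSum φ r (suc n) ≡ levelSum φ (leftChild u r) n + levelSum φ (rightChild v r) n
  levelSum-suc-root φ r n = begin
    sumℚ (map φ (level u v r (suc n)))      ≡⟨ cong (sumℚ ∘ map φ) (level-suc-root r n) ⟩
    sumℚ (map φ (ls ++ rs))                 ≡⟨ cong sumℚ (map-++ φ ls rs) ⟩
    sumℚ (map φ ls ++ map φ rs)             ≡⟨ sumℚ-++ (map φ ls) (map φ rs) ⟩
    sumℚ (map φ ls) + sumℚ (map φ rs)       ∎
    where
    open ≡-Reasoning
    ls = level u v (leftChild u r) n
    rs = level u v (rightChild v r) n

  levelSum-mono : ∀ φ → (∀ x y → x ≼ y → φ x ≤ φ y) →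
    ∀ n {x y} → x ≼ y → levelSum φ x n ≤ levelSum φ y n
  levelSum-mono φ φ-mono zero    {x} {y} x≼y = +-monoˡ-≤ 0ℚ (φ-mono x y x≼y)
  levelSum-mono φ φ-mono (suc n) {x} {y} x≼y = subst₂ _≤_
    (sym (levelSum-suc-root φ x n)) (sym (levelSum-suc-root φ y n))
    (+-mono-≤ (levelSum-mono φ φ-mono n (leftChild-mono u {x} {y} x≼y))
              (levelSum-mono φ φ-mono n (rightChild-mono v {x} {y} x≼y)))

  leftSum : Label → ℕ → ℚ
  leftSum = levelSum (val ∘ leftChild u)

  constSum : Label → ℕ → ℚ
  constSum = levelSum (const (val (v , 0)))

  constSum-suc : ∀ r n → constSum r (suc n) ≡ constSum r n + constSum r n
  constSum-suc r n = trans (levelSum-suc (const V) r n) (sumℚ-map-+ (const V) (const V) (level u v r n))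
    where V = val (v , 0)

  S-suc : ∀ r n → S u v r (suc n) ≡ S u v r n + (leftSum r n + constSum r n)
  S-suc r n = begin
    S u v r (suc n)
      ≡⟨ levelSum-suc val r n ⟩
    levelSum (λ x → val (leftChild u x) + val (rightChild v x)) r n
      ≡⟨ cong sumℚ (map-cong children-val xs) ⟩
    levelSum (λ x → val x + (val (leftChild u x) + V)) r n
      ≡⟨ sumℚ-map-+ val _ xs ⟩
    S u v r n + levelSum (λ x → val (leftChild u x) + V) r n
      ≡⟨ cong (S u v r n +_) (sumℚ-map-+ (val ∘ leftChild u) (const V) xs) ⟩
    S u v r n + (leftSum r n + constSum r n) ∎
    where
    open ≡-Reasoning
    V = val (v , 0)
    xs = level u v r n
    children-val : ∀ x → val (leftChild u x) + val (rightChild v x) ≡ val x + (val (leftChild u x) + V)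
    children-val x = trans (cong (val (leftChild u x) +_) (val-rightChild v x))
      (solve 3 (λ l x V → l :+ (x :+ V) := x :+ (l :+ V)) refl (val (leftChild u x)) (val x) V)
      where open ℚ-Solver

  module _ (z : Label) (z≼v : z ≼ (v , 0)) where

    partialLeftSum : ℕ → ℚ
    partialLeftSum zero  = 0ℚ
    partialLeftSum (suc n) = partialLeftSum n + leftSum z n

    partialLeftSum<leftSum : ∀ n a b .{{_ : NonZero a}} → partialLeftSum n < leftSum (a , b) n
    partialLeftSum<leftSum zero a b =
      <-respʳ-≡ (sym (+-identityʳ (val (a , u ℕ.* a ℕ.+ b)))) (val-pos a (u ℕ.* a ℕ.+ b))
    partialLeftSum<leftSum (suc n) a b = <-respʳ-≡ (sym (levelSum-suc-root _ (a , b) n))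
      (+-mono-<-≤ (partialLeftSum<leftSum n a (u ℕ.* a ℕ.+ b))
                  (levelSum-mono (val ∘ leftChild u) (val-leftChild-mono u) n
                                 (≼-rightChild v {z} (a , b) z≼v)))

    S≤constSum+partialLeftSum : ∀ n → S u v z n ≤ constSum z n + partialLeftSum n
    S≤constSum+partialLeftSum zero = begin
      val z + 0ℚ              ≤⟨ +-monoˡ-≤ 0ℚ (val-mono-≤ {z} {v , 0} z≼v) ⟩
      val (v , 0) + 0ℚ        ≡⟨ +-identityʳ (val (v , 0) + 0ℚ) ⟨
      val (v , 0) + 0ℚ + 0ℚ   ∎
      where open ≤-Reasoning
    S≤constSum+partialLeftSum (suc n) = begin
      S u v z (suc n)                ≡⟨ S-suc z n ⟩
      S u v z n + (G + C)            ≤⟨ +-monoˡ-≤ (G + C) (S≤constSum+partialLeftSum n) ⟩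
      (C + A) + (G + C)              ≡⟨ solve 3 (λ A G C → (C :+ A) :+ (G :+ C) := (C :+ C) :+ (A :+ G)) refl A G C ⟩
      (C + C) + (A + G)              ≡⟨ cong (_+ (A + G)) (constSum-suc z n) ⟨
      constSum z (suc n) + partialLeftSum (suc n) ∎
      where
      open ≤-Reasoning
      open ℚ-Solver
      A = partialLeftSum n
      G = leftSum z n
      C = constSum z n

    double-S<S-suc : .{{_ : NonZero (proj₁ z)}} → ∀ n → (1ℚ + 1ℚ) * S u v z n < S u v z (suc n)
    double-S<S-suc n = begin-strict
      (1ℚ + 1ℚ) * S u v z n     ≡⟨ solve 1 (λ s → (con 1ℚ :+ con 1ℚ) :* s := s :+ s) refl (S u v z n) ⟩
      S u v z n + S u v z n     <⟨ +-monoʳ-< (S u v z n) S<G+C ⟩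
      S u v z n + (G + C)       ≡⟨ S-suc z n ⟨
      S u v z (suc n)           ∎
      where
      open ≤-Reasoning
      open ℚ-Solver
      G = leftSum z n
      C = constSum z n
      S<G+C : S u v z n < G + C
      S<G+C = begin-strict
        S u v z n                       ≤⟨ S≤constSum+partialLeftSum n ⟩
        C + partialLeftSum n            <⟨ +-monoʳ-< C (partialLeftSum<leftSum n _ _) ⟩
        C + G                           ≡⟨ +-comm C G ⟩
        G + C                           ∎

lemma5 : (u v : ℕ) → .{{_ : NonZero u}} → .{{_ : NonZero v}} →
    (r : Label) → (r ≡ (1 , pred u) ⊎ r ≡ (v , 0)) →
    (n : ℕ) → (1ℚ + 1ℚ) * S u v r n < S u v r (suc n)
lemma5 u v .(1 , pred u) (inj₁ refl) =
  double-S<S-suc u v (1 , pred u) (ℕ.*-mono-≤ (>-nonZero⁻¹ v) (s≤s z≤n))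
lemma5 u v .(v , 0)      (inj₂ refl) = double-S<S-suc u v (v , 0) ℕ.≤-refl
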